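{- Let $\mathbf{L}\in\{\mathbf{K_n},\mathbf{KD_n},\mathbf{KT_n}\}$. For every $\mathcal{L}^1$-formula $A$: $\mathsf{H}(\mathbf{L})\vdash A$ if and only if $\mathsf{G}(\mathbf{L})\vdash\ \Rightarrow A$.
   Context: Formulas of $\mathcal{L}^1$ over a finite agent set $\mathsf{Agt}$ and countable $\mathsf{Prop}$: $A::=p\mid\bot\mid A\wedge A\mid A\vee A\mid A\rightarrow A\mid\neg A\mid\Box_i A$; $\top:=\neg\bot$. An outmost-boxed formula has the form $\Box_jB$; $\Box_i\Gamma=\{\Box_iA:A\in\Gamma\}$. Hilbert systems: $\mathsf{H}(\mathbf{K_n})$ has all classical propositional tautologies (in $\mathcal{L}^1$), the axioms $\Box_i(A\rightarrow B)\rightarrow(\Box_iA\rightarrow\Box_iB)$, modus ponens, and necessitation (from $A$ infer $\Box_iA$), for all $i\in\mathsf{Agt}$. $\mathsf{H}(\mathbf{KD_n})$ adds $\neg\Box_i\bot$; $\mathsf{H}(\mathbf{KT_n})$ adds $\Box_iA\rightarrow A$. Sequent calculi (sequents are pairs of finite multisets): $\mathsf{G}(\mathbf{K_n})$ has initial sequents $\Gamma,p\Rightarrow p,\Delta$ and $\bot,\Gamma\Rightarrow\Delta$; logical rules $(R\wedge)$: $\Gamma\Rightarrow\Delta,A_1$ and $\Gamma\Rightarrow\Delta,A_2$ / $\Gamma\Rightarrow\Delta,A_1\wedge A_2$; $(L\wedge)$: $A_1,A_2,\Gamma\Rightarrow\Delta$ / $A_1\wedge A_2,\Gamma\Rightarrow\Delta$;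 $(R\vee)$: $\Gamma\Rightarrow\Delta,A_1,A_2$ / $\Gamma\Rightarrow\Delta,A_1\vee A_2$; $(L\vee)$: $A_1,\Gamma\Rightarrow\Delta$ and $A_2,\Gamma\Rightarrow\Delta$ / $A_1\vee A_2,\Gamma\Rightarrow\Delta$; $(R\rightarrow)$: $A_1,\Gamma\Rightarrow\Delta,A_2$ / $\Gamma\Rightarrow\Delta,A_1\rightarrow A_2$; $(L\rightarrow)$: $\Gamma\Rightarrow\Delta,A_1$ and $A_2,\Gamma\Rightarrow\Delta$ / $A_1\rightarrow A_2,\Gamma\Rightarrow\Delta$; $(R\neg)$: $A,\Gamma\Rightarrow\Delta$ / $\Gamma\Rightarrow\Delta,\neg A$; $(L\neg)$: $\Gamma\Rightarrow\Delta,A$ / $\neg A,\Gamma\Rightarrow\Delta$; and $(\Box_{Kn})$: from $\Gamma\Rightarrow A$ infer $\Sigma,\Box_i\Gamma\Rightarrow\Box_iA,\Omega$, where members of $\Sigma$ are propositional variables, $\bot$, or $\Box_jB$ with $j\neq i$, and members of $\Omega$ are propositional variables, $\bot$, or outmost-boxed formulas. $\mathsf{G}(\mathbf{KD_n})$ adds $(\Box_{Dn})$: from $\Gamma\Rightarrow$ with $\Gamma\neq\emptyset$ infer $\Sigma,\Box_i\Gamma\Rightarrow\Omega$ ($\Sigma,\Omega$ as in $(\Box_{Kn})$). $\mathsf{G}(\mathbf{KT_n})$ adds $(\Box_{Tn})$: from $\Box_iA,A,\Gamma\Rightarrow\Delta$ infer $\Box_iA,\Gamma\Rightarrow\Delta$.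 -}

module Defs where

open import Data.Nat using (ℕ)
open import Data.Fin using (Fin)
open import Data.Bool using (Bool; true; false; _∧_; _∨_; not)
open import Data.List using (List; []; _∷_; _++_; map)
open import Data.List.Relation.Unary.All using (All)
open import Data.List.Relation.Binary.Permutation.Propositional using (_↭_)
open import Relation.Binary.PropositionalEquality using (_≡_)
open import Relation.Nullary using (¬_)

infixr 6 _∧′_
infixr 5 _∨′_
infixr 4 _⇒′_

data Fm (n : ℕ) : Set where
  var  : ℕ → Fm n
  ⊥′   : Fm n
  _∧′_ : Fm n → Fm n → Fm n
  _∨′_ : Fm n → Fm n → Fm n
  _⇒′_ : Fm n → Fm n → Fm n
  ¬′_  : Fm n → Fm n
  □    : Fin n → Fm n → Fm n

⊤′ : ∀ {n} → Fm n
⊤′ = ¬′ ⊥′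

-- Classical propositional evaluation, treating outmost-boxed formulas as atoms.
eval : ∀ {n} → (ℕ → Bool) → (Fin n → Fm n → Bool) → Fm n → Bool
eval vp vb (var p)   = vp p
eval vp vb ⊥′        = false
eval vp vb (A ∧′ B)  = eval vp vb A ∧ eval vp vb B
eval vp vb (A ∨′ B)  = eval vp vb A ∨ eval vp vb B
eval vp vb (A ⇒′ B)  = not (eval vp vb A) ∨ eval vp vb B
eval vp vb (¬′ A)    = not (eval vp vb A)
eval vp vb (□ i A)   = vb i A

Tautology : ∀ {n} → Fm n → Set
Tautology A = ∀ vp vb → eval vp vb A ≡ true

data Logic : Set where
  K KD KT : Logic

data H {n : ℕ} (L : Logic) : Fm n → Set where
  taut : ∀ {A} → Tautology A → H L A
  axK  : ∀ i A B → H L (□ i (A ⇒′ B) ⇒′ (□ i A ⇒′ □ i B))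
  axD  : L ≡ KD → ∀ i → H L (¬′ □ i ⊥′)
  axT  : L ≡ KT → ∀ i A → H L (□ i A ⇒′ A)
  mp   : ∀ {A B} → H L (A ⇒′ B) → H L A → H L B
  nec  : ∀ {A} i → H L A → H L (□ i A)

data SigmaOK {n : ℕ} (i : Fin n) : Fm n → Set where
  sv : ∀ p → SigmaOK i (var p)
  s⊥ : SigmaOK i ⊥′
  s□ : ∀ {j} B → ¬ (j ≡ i) → SigmaOK i (□ j B)

data OmegaOK {n : ℕ} : Fm n → Set where
  ov : ∀ p → OmegaOK (var p)
  o⊥ : OmegaOK ⊥′
  o□ : ∀ j B → OmegaOK (□ j B)

infix 3 _⊢_⇒_

-- Sequent calculi G(L). Sequents are pairs of finite multisets, represented
-- as lists identified up to permutation (constructor perm).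
data _⊢_⇒_ {n : ℕ} (L : Logic) : List (Fm n) → List (Fm n) → Set where
  perm : ∀ {Γ Γ′ Δ Δ′} → Γ ↭ Γ′ → Δ ↭ Δ′ → L ⊢ Γ ⇒ Δ → L ⊢ Γ′ ⇒ Δ′
  init : ∀ {Γ Δ} p → L ⊢ var p ∷ Γ ⇒ var p ∷ Δ
  init⊥ : ∀ {Γ Δ} → L ⊢ ⊥′ ∷ Γ ⇒ Δ
  R∧ : ∀ {Γ Δ A₁ A₂} → L ⊢ Γ ⇒ A₁ ∷ Δ → L ⊢ Γ ⇒ A₂ ∷ Δ → L ⊢ Γ ⇒ (A₁ ∧′ A₂) ∷ Δ
  L∧ : ∀ {Γ Δ A₁ A₂} → L ⊢ A₁ ∷ A₂ ∷ Γ ⇒ Δ → L ⊢ (A₁ ∧′ A₂) ∷ Γ ⇒ Δ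
  R∨ : ∀ {Γ Δ A₁ A₂} → L ⊢ Γ ⇒ A₁ ∷ A₂ ∷ Δ → L ⊢ Γ ⇒ (A₁ ∨′ A₂) ∷ Δ
  L∨ : ∀ {Γ Δ A₁ A₂} → L ⊢ A₁ ∷ Γ ⇒ Δ → L ⊢ A₂ ∷ Γ ⇒ Δ → L ⊢ (A₁ ∨′ A₂) ∷ Γ ⇒ Δ
  R⇒ : ∀ {Γ Δ A₁ A₂} → L ⊢ A₁ ∷ Γ ⇒ A₂ ∷ Δ → L ⊢ Γ ⇒ (A₁ ⇒′ A₂) ∷ Δ
  L⇒ : ∀ {Γ Δ A₁ A₂} → L ⊢ Γ ⇒ A₁ ∷ Δ → L ⊢ A₂ ∷ Γ ⇒ Δ → L ⊢ (A₁ ⇒′ A₂) ∷ Γ ⇒ Δ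
  R¬ : ∀ {Γ Δ A} → L ⊢ A ∷ Γ ⇒ Δ → L ⊢ Γ ⇒ (¬′ A) ∷ Δ
  L¬ : ∀ {Γ Δ A} → L ⊢ Γ ⇒ A ∷ Δ → L ⊢ (¬′ A) ∷ Γ ⇒ Δ
  □K : ∀ {Γ A Σ Ω} i → All (SigmaOK i) Σ → All OmegaOK Ω →
       L ⊢ Γ ⇒ A ∷ [] → L ⊢ Σ ++ map (□ i) Γ ⇒ □ i A ∷ Ω
  □D : ∀ {Γ Σ Ω} → L ≡ KD → ∀ i → ¬ (Γ ≡ []) → All (SigmaOK i) Σ → All OmegaOK Ω →
       L ⊢ Γ ⇒ [] → L ⊢ Σ ++ map (□ i) Γ ⇒ Ω
  □T : ∀ {Γ Δ A} → L ≡ KT → ∀ i → L ⊢ □ i A ∷ A ∷ Γ ⇒ Δ → L ⊢ □ i A ∷ Γ ⇒ Δ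

{-# OPTIONS --safe #-}
module Submission where

-- From G(L) to H(L): read a sequent Γ ⇒ Δ as the formula ⋀Γ → ⋁Δ. The structural
-- and propositional rules of G(L) then yield tautological consequences, □K follows
-- from the K lemma (if ⋀Γ → A is provable then so is ⋀□Γ → □A), and □D and □T add
-- the axioms ¬□⊥ and □A → A.
--
-- From H(L) to G(L): H(L) is sound for finite trees in which a node may be its own
-- successor, every node being reflexive for KT and reflexive or serial for KD.
-- Backward proof search in G(L) terminates: the propositional rules are invertible,
-- atoms and boxes are set aside (in KT a box on the left also leaves its body behind),
-- and a sequent of atoms and boxes is closed by an initial sequent, by □K for some
-- box on the right or, in KD, by □D. If none of these applies, the failed searches
-- for the premises of □K and □D supply the successors of a refuting root. So if
-- ⇒ A is not derivable, A fails in such a tree and H(L) does not prove it.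

open import Defs

open import Algebra.Properties.CommutativeSemigroup using (x∙yz≈y∙xz)
open import Data.Bool using (Bool; true; false; T; not; _∨_)
open import Data.Bool.Properties using (T-≡; T-∧; T-∨)
open import Data.Empty using (⊥; ⊥-elim)
open import Data.Fin using (Fin; _≟_)
open import Data.List using (List; []; _∷_; _++_; map; foldr; length; allFin)
open import Data.List.Membership.Propositional using (_∈_; _∉_)
open import Data.List.Membership.Propositional.Properties using (∈-∃++; ∈-map⁺; ∈-allFin)
open import Data.List.Properties using (++-identityʳ)
import Data.List.Relation.Unary.All as All
open import Data.List.Relation.Unary.All using (All; []; _∷_; all?; zipWith; universal; lookup)
open import Data.List.Relation.Unary.All.Properties
  using (++⁻ʳ; Any¬⇒¬All) renaming (map⁺ to All-map⁺)
open import Data.List.Relation.Unary.Any using (Any; here; there; any?)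
open import Data.List.Relation.Unary.Any.Properties
  using (¬Any[]; singleton⁻; ++⁺ˡ; ++⁺ʳ) renaming (map⁺ to Any-map⁺)
open import Data.List.Relation.Binary.Permutation.Propositional
  using (_↭_; ↭-refl; ↭-sym; ↭-trans; ↭-reflexive; prep)
open import Data.List.Relation.Binary.Permutation.Propositional.Properties
  using (All-resp-↭; Any-resp-↭; shift)
open import Data.Nat using (ℕ; suc; _+_; _≤_; _<_; z≤n; s≤s)
import Data.Nat as ℕ
open import Data.Nat.Induction using (<-wellFounded)
open import Data.Nat.ListAction using (sum)
open import Data.Nat.Properties
  using (≤-refl; ≤-reflexive; ≤-trans; m≤m+n; m≤n+m; m<m+n; m+n≤o⇒m≤o; +-suc; +-assoc; +-comm;
         +-identityʳ; +-monoʳ-≤; +-monoˡ-≤; +-mono-<-≤; +-commutativeSemigroup; module ≤-Reasoning)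
open import Data.Nat.Tactic.RingSolver using (solve-∀)
open import Data.Product using (_×_; _,_; proj₁; proj₂; ∃; Σ-syntax)
open import Data.Product.Function.NonDependent.Propositional using (_×-⇔_)
open import Data.Sum using (_⊎_; inj₁; inj₂; [_,_])
import Data.Sum as Sum
import Data.Sum.Effectful.Left as SumLeft
open import Data.Sum.Function.Propositional using (_⊎-⇔_)
open import Data.Unit using (⊤)
open import Function using (id; _∘_; _⇔_; mk⇔; Equivalence)
open import Function.Construct.Composition using (_⇔-∘_)
open import Function.Construct.Symmetry using (⇔-sym)
open import Function.Related.TypeIsomorphisms using (→-cong-⇔; ¬-cong-⇔)
open import Induction.WellFounded using (Acc; acc)
open import Level using (0ℓ)
open import Relation.Binary.PropositionalEquality using (_≡_; _≢_; refl; sym; trans; cong; subst)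
open import Relation.Nullary using (¬_; Dec; yes; no)
open import Relation.Nullary.Decidable
  using (T?; map′; ¬?; _×-dec_; _⊎-dec_; _→-dec_; isYes; fromWitness; toWitness)


open Equivalence using (to; from)

private variable
  n p : ℕ
  L : Logic
  i : Fin n
  A B C : Fm n
  Γ Γ′ Γ″ Δ Δ′ Δ″ : List (Fm n)

-- Tautological consequence in H(L)

Valuation : ℕ → Set
Valuation n = (ℕ → Bool) × (Fin n → Fm n → Bool)

infix 3 _⊨_ _⊨_⇒_

_⊨_ : Valuation n → Fm n → Set
ρ ⊨ var p  = T (proj₁ ρ p)
ρ ⊨ ⊥′     = ⊥
ρ ⊨ A ∧′ B = ρ ⊨ A × ρ ⊨ B
ρ ⊨ A ∨′ B = ρ ⊨ A ⊎ ρ ⊨ B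
ρ ⊨ A ⇒′ B = ρ ⊨ A → ρ ⊨ B
ρ ⊨ ¬′ A   = ¬ (ρ ⊨ A)
ρ ⊨ □ i A  = T (proj₂ ρ i A)

private variable ρ : Valuation n

T-⇒ : ∀ {x y} → T (not x ∨ y) ⇔ (T x → T y)
T-⇒ {true}  = mk⇔ (λ y _ → y) (λ f → f _)
T-⇒ {false} = mk⇔ (λ _ ()) _

T-not : ∀ {x} → T (not x) ⇔ (¬ T x)
T-not {true}  = mk⇔ (λ ()) (λ f → f _)
T-not {false} = mk⇔ (λ _ ()) _

⊨⇔eval : ∀ A → (ρ ⊨ A) ⇔ T (eval (proj₁ ρ) (proj₂ ρ) A)
⊨⇔eval (var p)  = mk⇔ id id
⊨⇔eval ⊥′       = mk⇔ id id
⊨⇔eval (A ∧′ B) = ⇔-sym T-∧ ⇔-∘ (⊨⇔eval A ×-⇔ ⊨⇔eval B)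
⊨⇔eval (A ∨′ B) = ⇔-sym T-∨ ⇔-∘ (⊨⇔eval A ⊎-⇔ ⊨⇔eval B)
⊨⇔eval (A ⇒′ B) = ⇔-sym T-⇒ ⇔-∘ →-cong-⇔ (⊨⇔eval A) (⊨⇔eval B)
⊨⇔eval (¬′ A)   = ⇔-sym T-not ⇔-∘ ¬-cong-⇔ (⊨⇔eval A)
⊨⇔eval (□ i A)  = mk⇔ id id

_⊨?_ : ∀ ρ (A : Fm n) → Dec (ρ ⊨ A)
ρ ⊨? A = map′ (from (⊨⇔eval A)) (to (⊨⇔eval A)) (T? _)

H-valid : (∀ ρ → ρ ⊨ A) → H L A
H-valid {A = A} f = taut λ vp vb → to T-≡ (to (⊨⇔eval A) (f (vp , vb)))

H-consequence : (∀ ρ → ρ ⊨ A → ρ ⊨ B) → H L A → H L B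
H-consequence f = mp (H-valid f)

H-consequence₂ : (∀ ρ → ρ ⊨ A → ρ ⊨ B → ρ ⊨ C) → H L A → H L B → H L C
H-consequence₂ f hA hB = mp (mp (H-valid f) hA) hB

-- Soundness of G(L) with respect to H(L)

⋀ ⋁ : List (Fm n) → Fm n
⋀ = foldr _∧′_ ⊤′
⋁ = foldr _∨′_ ⊥′

⌜_⇒_⌝ : List (Fm n) → List (Fm n) → Fm n
⌜ Γ ⇒ Δ ⌝ = ⋀ Γ ⇒′ ⋁ Δ

_⊨_⇒_ : Valuation n → List (Fm n) → List (Fm n) → Set
ρ ⊨ Γ ⇒ Δ = All (ρ ⊨_) Γ → Any (ρ ⊨_) Δ

⊨⋀⇔All : ∀ Γ → (ρ ⊨ ⋀ Γ) ⇔ All (ρ ⊨_) Γ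
⊨⋀⇔All []      = mk⇔ (λ _ → []) (λ _ ())
⊨⋀⇔All (A ∷ Γ) = mk⇔ (λ (a , γ) → a ∷ to (⊨⋀⇔All Γ) γ)
                     (λ { (a ∷ γ) → a , from (⊨⋀⇔All Γ) γ })

⊨⋁⇔Any : ∀ Δ → (ρ ⊨ ⋁ Δ) ⇔ Any (ρ ⊨_) Δ
⊨⋁⇔Any []      = mk⇔ (λ ()) (λ ())
⊨⋁⇔Any (A ∷ Δ) = mk⇔ [ here , there ∘ to (⊨⋁⇔Any Δ) ]
                     (λ { (here a) → inj₁ a ; (there δ) → inj₂ (from (⊨⋁⇔Any Δ) δ) })

⊨⌜⇒⌝ : ∀ Γ Δ → (ρ ⊨ ⌜ Γ ⇒ Δ ⌝) ⇔ (ρ ⊨ Γ ⇒ Δ)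
⊨⌜⇒⌝ Γ Δ = →-cong-⇔ (⊨⋀⇔All Γ) (⊨⋁⇔Any Δ)

infix 3 _⊢ᴴ_⇒_

-- A record rather than H L ⌜ Γ ⇒ Δ ⌝ itself, so that Γ and Δ can be inferred from it.
record _⊢ᴴ_⇒_ (L : Logic) (Γ Δ : List (Fm n)) : Set where
  constructor ⌜_⌝
  field H-proof : H L ⌜ Γ ⇒ Δ ⌝

⊢ᴴ-valid : (∀ {ρ} → ρ ⊨ Γ ⇒ Δ) → L ⊢ᴴ Γ ⇒ Δ
⊢ᴴ-valid {Γ = Γ} {Δ = Δ} s = ⌜ H-valid (λ _ → from (⊨⌜⇒⌝ Γ Δ) s) ⌝

⊢ᴴ-rule₁ : (∀ {ρ} → ρ ⊨ Γ ⇒ Δ → ρ ⊨ Γ′ ⇒ Δ′) → L ⊢ᴴ Γ ⇒ Δ → L ⊢ᴴ Γ′ ⇒ Δ′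
⊢ᴴ-rule₁ {Γ = Γ} {Δ = Δ} {Γ′ = Γ′} {Δ′ = Δ′} f ⌜ h ⌝ =
  ⌜ H-consequence (λ _ → from (⊨⌜⇒⌝ Γ′ Δ′) ∘ f ∘ to (⊨⌜⇒⌝ Γ Δ)) h ⌝

⊢ᴴ-rule₂ : (∀ {ρ} → ρ ⊨ Γ ⇒ Δ → ρ ⊨ Γ′ ⇒ Δ′ → ρ ⊨ Γ″ ⇒ Δ″) →
           L ⊢ᴴ Γ ⇒ Δ → L ⊢ᴴ Γ′ ⇒ Δ′ → L ⊢ᴴ Γ″ ⇒ Δ″
⊢ᴴ-rule₂ {Γ = Γ} {Δ = Δ} {Γ′ = Γ′} {Δ′ = Δ′} {Γ″ = Γ″} {Δ″ = Δ″} f ⌜ h ⌝ ⌜ h′ ⌝ =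
  ⌜ H-consequence₂ (λ _ s s′ → from (⊨⌜⇒⌝ Γ″ Δ″) (f (to (⊨⌜⇒⌝ Γ Δ) s) (to (⊨⌜⇒⌝ Γ′ Δ′) s′)))
                   h h′ ⌝

⊢ᴴ-rule-using : (∀ {ρ} → ρ ⊨ C → ρ ⊨ Γ ⇒ Δ → ρ ⊨ Γ′ ⇒ Δ′) →
                H L C → L ⊢ᴴ Γ ⇒ Δ → L ⊢ᴴ Γ′ ⇒ Δ′
⊢ᴴ-rule-using {Γ = Γ} {Δ = Δ} {Γ′ = Γ′} {Δ′ = Δ′} f c ⌜ h ⌝ =
  ⌜ H-consequence₂ (λ _ c s → from (⊨⌜⇒⌝ Γ′ Δ′) (f c (to (⊨⌜⇒⌝ Γ Δ) s))) c h ⌝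

⊢ᴴ⇔H : (L ⊢ᴴ [] ⇒ A ∷ []) ⇔ H L A
⊢ᴴ⇔H {A = A} =
  mk⇔ (λ { ⌜ h ⌝ → H-consequence (λ _ s → singleton⁻ (to (⊨⌜⇒⌝ [] (A ∷ [])) s [])) h })
      (λ h → ⌜ H-consequence (λ _ a → from (⊨⌜⇒⌝ [] (A ∷ [])) λ _ → here a) h ⌝)

⊨-R∧ : ρ ⊨ Γ ⇒ A ∷ Δ → ρ ⊨ Γ ⇒ B ∷ Δ → ρ ⊨ Γ ⇒ (A ∧′ B) ∷ Δ
⊨-R∧ sA sB γ with sA γ | sB γ
... | here a  | here b  = here (a , b)
... | there δ | _       = there δ
... | here _  | there δ = there δ

⊨-L∧ : ρ ⊨ A ∷ B ∷ Γ ⇒ Δ → ρ ⊨ (A ∧′ B) ∷ Γ ⇒ Δ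
⊨-L∧ s ((a , b) ∷ γ) = s (a ∷ b ∷ γ)

⊨-R∨ : ρ ⊨ Γ ⇒ A ∷ B ∷ Δ → ρ ⊨ Γ ⇒ (A ∨′ B) ∷ Δ
⊨-R∨ s γ with s γ
... | here a          = here (inj₁ a)
... | there (here b)  = here (inj₂ b)
... | there (there δ) = there δ

⊨-L∨ : ρ ⊨ A ∷ Γ ⇒ Δ → ρ ⊨ B ∷ Γ ⇒ Δ → ρ ⊨ (A ∨′ B) ∷ Γ ⇒ Δ
⊨-L∨ sA sB (inj₁ a ∷ γ) = sA (a ∷ γ)
⊨-L∨ sA sB (inj₂ b ∷ γ) = sB (b ∷ γ)

⊨-R⇒ : ρ ⊨ A ∷ Γ ⇒ B ∷ Δ → ρ ⊨ Γ ⇒ (A ⇒′ B) ∷ Δ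
⊨-R⇒ {ρ = ρ} {A = A} s γ with ρ ⊨? A
... | no ¬a = here (⊥-elim ∘ ¬a)
... | yes a with s (a ∷ γ)
...   | here b  = here (λ _ → b)
...   | there δ = there δ

⊨-L⇒ : ρ ⊨ Γ ⇒ A ∷ Δ → ρ ⊨ B ∷ Γ ⇒ Δ → ρ ⊨ (A ⇒′ B) ∷ Γ ⇒ Δ
⊨-L⇒ sA sB (f ∷ γ) with sA γ
... | here a  = sB (f a ∷ γ)
... | there δ = δ

⊨-R¬ : ρ ⊨ A ∷ Γ ⇒ Δ → ρ ⊨ Γ ⇒ (¬′ A) ∷ Δ
⊨-R¬ {ρ = ρ} {A = A} s γ with ρ ⊨? A
... | no ¬a = here ¬a
... | yes a = there (s (a ∷ γ))

⊨-L¬ : ρ ⊨ Γ ⇒ A ∷ Δ → ρ ⊨ (¬′ A) ∷ Γ ⇒ Δ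
⊨-L¬ s (¬a ∷ γ) with s γ
... | here a  = ⊥-elim (¬a a)
... | there δ = δ

⊨-K : ρ ⊨ □ i (B ⇒′ A) ⇒′ □ i B ⇒′ □ i A →
      ρ ⊨ map (□ i) Γ ⇒ □ i (B ⇒′ A) ∷ [] → ρ ⊨ map (□ i) (B ∷ Γ) ⇒ □ i A ∷ []
⊨-K k s (b ∷ γ) = here (k (singleton⁻ (s γ)) b)

⊢ᴴ-□ : L ⊢ᴴ Γ ⇒ A ∷ [] → L ⊢ᴴ map (□ i) Γ ⇒ □ i A ∷ []
⊢ᴴ-□ {Γ = []}              = from ⊢ᴴ⇔H ∘ nec _ ∘ to ⊢ᴴ⇔H
⊢ᴴ-□ {Γ = B ∷ Γ} {A} {i} h = ⊢ᴴ-rule-using ⊨-K (axK i B A) (⊢ᴴ-□ (⊢ᴴ-rule₁ ⊨-R⇒ h))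

G⇒H : L ⊢ Γ ⇒ Δ → L ⊢ᴴ Γ ⇒ Δ
G⇒H (perm Γ↭ Δ↭ d) = ⊢ᴴ-rule₁ (λ s → Any-resp-↭ Δ↭ ∘ s ∘ All-resp-↭ (↭-sym Γ↭)) (G⇒H d)
G⇒H (init p)       = ⊢ᴴ-valid λ { (a ∷ _) → here a }
G⇒H init⊥          = ⊢ᴴ-valid λ { (() ∷ _) }
G⇒H (R∧ d e)       = ⊢ᴴ-rule₂ ⊨-R∧ (G⇒H d) (G⇒H e)
G⇒H (L∧ d)         = ⊢ᴴ-rule₁ ⊨-L∧ (G⇒H d)
G⇒H (R∨ d)         = ⊢ᴴ-rule₁ ⊨-R∨ (G⇒H d)
G⇒H (L∨ d e)       = ⊢ᴴ-rule₂ ⊨-L∨ (G⇒H d) (G⇒H e)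
G⇒H (R⇒ d)         = ⊢ᴴ-rule₁ ⊨-R⇒ (G⇒H d)
G⇒H (L⇒ d e)       = ⊢ᴴ-rule₂ ⊨-L⇒ (G⇒H d) (G⇒H e)
G⇒H (R¬ d)         = ⊢ᴴ-rule₁ ⊨-R¬ (G⇒H d)
G⇒H (L¬ d)         = ⊢ᴴ-rule₁ ⊨-L¬ (G⇒H d)
G⇒H (□K {Σ = Σ} i _ _ d) = ⊢ᴴ-rule₁ (λ s → ++⁺ˡ ∘ s ∘ ++⁻ʳ Σ) (⊢ᴴ-□ (G⇒H d))
G⇒H (□D {Σ = Σ} L≡KD i _ _ _ d) =
  ⊢ᴴ-rule-using (λ ¬□⊥ s → ⊥-elim ∘ ¬□⊥ ∘ singleton⁻ ∘ s ∘ ++⁻ʳ Σ) (axD L≡KD i)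
    (⊢ᴴ-□ (⊢ᴴ-rule₁ (λ s → ⊥-elim ∘ ¬Any[] ∘ s) (G⇒H d)))
G⇒H (□T L≡KT i d) = ⊢ᴴ-rule-using (λ { t s (b ∷ γ) → s (b ∷ t b ∷ γ) }) (axT L≡KT i _) (G⇒H d)

-- Tree models and soundness of H(L)

-- A node flagged reflexive is one of its own successors for every agent; this keeps
-- the models of KT and KD needed below finite.
record Tree (n : ℕ) : Set where
  inductive
  constructor node
  field
    reflexive : Bool
    val       : ℕ → Bool
    children  : Fin n → List (Tree n)

open Tree

private variable
  t : Tree n
  ts : List (Tree n)

infix 3 _⊩_ _⊮_ _⊩?_

_⊩_ : Tree n → Fm n → Set
t ⊩ var p  = T (val t p)
t ⊩ ⊥′     = ⊥
t ⊩ A ∧′ B = t ⊩ A × t ⊩ B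
t ⊩ A ∨′ B = t ⊩ A ⊎ t ⊩ B
t ⊩ A ⇒′ B = t ⊩ A → t ⊩ B
t ⊩ ¬′ A   = ¬ (t ⊩ A)
t ⊩ □ i A  = (T (reflexive t) → t ⊩ A) × All (_⊩ A) (children t i)

_⊮_ : Tree n → Fm n → Set
t ⊮ A = ¬ (t ⊩ A)

_⊩?_ : ∀ (t : Tree n) A → Dec (t ⊩ A)
t ⊩? var p  = T? (val t p)
t ⊩? ⊥′     = no id
t ⊩? A ∧′ B = t ⊩? A ×-dec t ⊩? B
t ⊩? A ∨′ B = t ⊩? A ⊎-dec t ⊩? B
t ⊩? A ⇒′ B = t ⊩? A →-dec t ⊩? B
t ⊩? ¬′ A   = ¬? (t ⊩? A)
t ⊩? □ i A  = (T? (reflexive t) →-dec t ⊩? A) ×-dec all? (_⊩? A) (children t i)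

valuation : Tree n → Valuation n
valuation t = val t , λ i A → isYes (t ⊩? □ i A)

⊩⇔⊨ : ∀ A → (t ⊩ A) ⇔ (valuation t ⊨ A)
⊩⇔⊨ (var p)  = mk⇔ id id
⊩⇔⊨ ⊥′       = mk⇔ id id
⊩⇔⊨ (A ∧′ B) = ⊩⇔⊨ A ×-⇔ ⊩⇔⊨ B
⊩⇔⊨ (A ∨′ B) = ⊩⇔⊨ A ⊎-⇔ ⊩⇔⊨ B
⊩⇔⊨ (A ⇒′ B) = →-cong-⇔ (⊩⇔⊨ A) (⊩⇔⊨ B)
⊩⇔⊨ (¬′ A)   = ¬-cong-⇔ (⊩⇔⊨ A)
⊩⇔⊨ (□ i A)  = mk⇔ fromWitness toWitness

data Admissible (L : Logic) : Tree n → Set where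
  admissible : (L ≡ KT → T (reflexive t)) →
               (L ≡ KD → T (reflexive t) ⊎ (∀ i → children t i ≢ [])) →
               (∀ i → All (Admissible L) (children t i)) →
               Admissible L t

mutual
  H-sound : H L A → Admissible L t → t ⊩ A
  H-sound {A = A} (taut τ) _ = from (⊩⇔⊨ A) (from (⊨⇔eval A) (from T-≡ (τ _ _)))
  H-sound (axK i A B) _ (f , fs) (a , as) = (λ r → f r (a r)) , zipWith (λ (f , a) → f a) (fs , as)
  H-sound (axD L≡KD i) (admissible _ serial _) (⊥-here , ⊥-children) with serial L≡KD
  ... | inj₁ r  = ⊥-here r
  ... | inj₂ ne = ne i (no-children ⊥-children)
    where
    no-children : All (_⊩ ⊥′) ts → ts ≡ []
    no-children [] = refl
  H-sound (axT L≡KT i A) (admissible reflexive-KT _ _) (a , _) = a (reflexive-KT L≡KT)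
  H-sound (mp h h′) a = H-sound h a (H-sound h′ a)
  H-sound (nec i h) a@(admissible _ _ kids) = (λ _ → H-sound h a) , H-sound-All h (kids i)

  H-sound-All : H L A → All (Admissible L) ts → All (_⊩ A) ts
  H-sound-All h []       = []
  H-sound-All h (a ∷ as) = H-sound h a ∷ H-sound-All h as

-- Proof search in G(L)

-- Formulas parked by the search until nothing else remains: Λ on the left, Ω on the right.
data LeftAtom (n : ℕ) : Set where
  var : ℕ → LeftAtom n
  □   : Fin n → Fm n → LeftAtom n

data RightAtom (n : ℕ) : Set where
  var : ℕ → RightAtom n
  ⊥′  : RightAtom n
  □   : Fin n → Fm n → RightAtom n

⌊_⌋ˡ : LeftAtom n → Fm n
⌊ var p ⌋ˡ = var p
⌊ □ i A ⌋ˡ = □ i A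

⌊_⌋ʳ : RightAtom n → Fm n
⌊ var p ⌋ʳ = var p
⌊ ⊥′ ⌋ʳ    = ⊥′
⌊ □ i A ⌋ʳ = □ i A

private variable
  Λ Λ′ Λ″ : List (LeftAtom n)
  Ω Ω′ Ω″ : List (RightAtom n)

⌊⌋ʳ-OmegaOK : (Ω : List (RightAtom n)) → All OmegaOK (map ⌊_⌋ʳ Ω)
⌊⌋ʳ-OmegaOK = All-map⁺ ∘ universal λ where
  (var p) → ov p
  ⊥′      → o⊥
  (□ i A) → o□ i A

bodies : Fin n → List (LeftAtom n) → List (Fm n)
bodies i []          = []
bodies i (var p ∷ Λ) = bodies i Λ
bodies i (□ j A ∷ Λ) with j ≟ i
... | yes _ = A ∷ bodies i Λ
... | no _  = bodies i Λ

others : Fin n → List (LeftAtom n) → List (Fm n)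
others i []          = []
others i (var p ∷ Λ) = var p ∷ others i Λ
others i (□ j A ∷ Λ) with j ≟ i
... | yes _ = others i Λ
... | no _  = □ j A ∷ others i Λ

others-SigmaOK : ∀ i Λ → All (SigmaOK i) (others {n} i Λ)
others-SigmaOK i []          = []
others-SigmaOK i (var p ∷ Λ) = sv p ∷ others-SigmaOK i Λ
others-SigmaOK i (□ j A ∷ Λ) with j ≟ i
... | yes _  = others-SigmaOK i Λ
... | no j≢i = s□ A j≢i ∷ others-SigmaOK i Λ

↭-others-bodies : ∀ i Λ → map ⌊_⌋ˡ Λ ↭ others {n} i Λ ++ map (□ i) (bodies i Λ)
↭-others-bodies i []          = ↭-refl
↭-others-bodies i (var p ∷ Λ) = prep (var p) (↭-others-bodies i Λ)
↭-others-bodies i (□ j A ∷ Λ) with j ≟ i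
... | yes refl = ↭-trans (prep (□ i A) (↭-others-bodies i Λ)) (↭-sym (shift (□ i A) (others i Λ) _))
... | no _     = prep (□ j A) (↭-others-bodies i Λ)

∈-bodies : ∀ Λ → □ i A ∈ Λ → A ∈ bodies i Λ
∈-bodies {i = i} (□ j B ∷ Λ) m with j ≟ i | m
... | yes _  | here refl = here refl
... | yes _  | there m   = there (∈-bodies Λ m)
... | no j≢i | here refl = ⊥-elim (j≢i refl)
... | no _   | there m   = ∈-bodies Λ m
∈-bodies (var p ∷ Λ) (there m) = ∈-bodies Λ m

-- □ A outweighs A together with a parked □ A, so that in KT the rule for □ on the
-- left, which produces both, still decreases the measure.
weight : Fm n → ℕ
weight (var p)  = 1
weight ⊥′       = 1
weight (A ∧′ B) = suc (weight A + weight B)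
weight (A ∨′ B) = suc (weight A + weight B)
weight (A ⇒′ B) = suc (weight A + weight B)
weight (¬′ A)   = suc (weight A)
weight (□ i A)  = suc (suc (weight A + weight A))

weightˡ : LeftAtom n → ℕ
weightˡ (var p) = 0
weightˡ (□ i A) = suc (weight A)

weightʳ : RightAtom n → ℕ
weightʳ (var p) = 0
weightʳ ⊥′      = 0
weightʳ (□ i A) = suc (weight A)

weights : List (Fm n) → ℕ
weights Γ = sum (map weight Γ)

weightsˡ : List (LeftAtom n) → ℕ
weightsˡ Λ = sum (map weightˡ Λ)

weightsʳ : List (RightAtom n) → ℕ
weightsʳ Ω = sum (map weightʳ Ω)

measure : List (Fm n) → List (Fm n) → List (LeftAtom n) → List (RightAtom n) → ℕ
measure Γ Δ Λ Ω = weights (Γ ++ Δ) + (weightsˡ Λ + weightsʳ Ω)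

weights-++-∷ : ∀ Γ A Δ → weights (Γ ++ A ∷ Δ) ≡ weight {n} A + weights (Γ ++ Δ)
weights-++-∷ []      A Δ = refl
weights-++-∷ (B ∷ Γ) A Δ =
  trans (cong (weight B +_) (weights-++-∷ Γ A Δ))
        (x∙yz≈y∙xz +-commutativeSemigroup (weight B) (weight A) _)

∈⇒weightʳ≤ : ∀ {a} Ω → a ∈ Ω → weightʳ {n} a ≤ weightsʳ Ω
∈⇒weightʳ≤ (a ∷ Ω) (here refl) = m≤m+n _ _
∈⇒weightʳ≤ (b ∷ Ω) (there m)   = ≤-trans (∈⇒weightʳ≤ Ω m) (m≤n+m _ _)

bodies-weight : ∀ i Λ → weights (bodies {n} i Λ) + length (bodies i Λ) ≤ weightsˡ Λ
bodies-weight i []          = z≤n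
bodies-weight i (var p ∷ Λ) = bodies-weight i Λ
bodies-weight i (□ j A ∷ Λ) with j ≟ i
... | no _  = ≤-trans (bodies-weight i Λ) (m≤n+m _ _)
... | yes _ = begin
  weight A + weights (bodies i Λ) + suc (length (bodies i Λ))   ≡⟨ +-suc _ _ ⟩
  suc (weight A + weights (bodies i Λ) + length (bodies i Λ))   ≡⟨ cong suc (+-assoc (weight A) _ _) ⟩
  suc (weight A + (weights (bodies i Λ) + length (bodies i Λ))) ≤⟨ s≤s (+-monoʳ-≤ (weight A) (bodies-weight i Λ)) ⟩
  suc (weight A + weightsˡ Λ)                                   ∎
  where
  open ≤-Reasoning

both-< : ∀ a b {x s} → a + (b + x) + s < suc (a + b) + x + s
both-< a b {x} {s} = s≤s (≤-reflexive (cong (_+ s) (sym (+-assoc a b x))))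

left-< : ∀ a b {x s} → a + x + s < suc (a + b) + x + s
left-< a b {x} {s} = s≤s (+-monoˡ-≤ s (+-monoˡ-≤ x (m≤m+n a b)))

right-< : ∀ a b {x s} → b + x + s < suc (a + b) + x + s
right-< a b {x} {s} = s≤s (+-monoˡ-≤ s (+-monoˡ-≤ x (m≤n+m b a)))

moved-< : ∀ Γ A Δ {s m} → weight {n} A + weights (Γ ++ Δ) + s < m → weights (Γ ++ A ∷ Δ) + s < m
moved-< Γ A Δ {s} = subst (λ k → k + s < _) (sym (weights-++-∷ Γ A Δ))

□-left-reflexive-< : ∀ a {x l o} → a + x + (suc a + l + o) < suc (suc (a + a)) + x + (l + o)
□-left-reflexive-< a {x} {l} {o} = ≤-reflexive (eq a x l o)
  where
  eq : ∀ a x l o → suc (a + x + (suc a + l + o)) ≡ suc (suc (a + a)) + x + (l + o)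
  eq = solve-∀

□-left-< : ∀ a {x l o} → x + (suc a + l + o) < suc (suc (a + a)) + x + (l + o)
□-left-< a {x} = ≤-trans (s≤s (+-monoˡ-≤ _ (m≤n+m x a))) (□-left-reflexive-< a)

□-right-< : ∀ a {x l o} → x + (l + (suc a + o)) < suc (suc (a + a)) + x + (l + o)
□-right-< a {x} {l} {o} = ≤-trans (s≤s (m≤m+n _ a)) (≤-reflexive (eq a x l o))
  where
  eq : ∀ a x l o → suc (x + (l + (suc a + o)) + a) ≡ suc (suc (a + a)) + x + (l + o)
  eq = solve-∀

isKT : Logic → Bool
isKT KT = true
isKT _  = false

T-isKT : L ≡ KT → T (isKT L)
T-isKT refl = _

KT? : ∀ L → L ≡ KT ⊎ ¬ T (isKT L)
KT? K  = inj₂ id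
KT? KD = inj₂ id
KT? KT = inj₁ refl

KD? : ∀ L → L ≡ KD ⊎ L ≢ KD
KD? K  = inj₂ λ ()
KD? KD = inj₁ refl
KD? KT = inj₂ λ ()

-- A box parked on the left need only hold at the successors. At the root of a
-- countermodel this suffices: the root is reflexive only in KT, where the body of
-- the box joined the antecedent when the box was parked.
_⊩ˡ_ : Tree n → LeftAtom n → Set
t ⊩ˡ var p = T (val t p)
t ⊩ˡ □ i A = All (_⊩ A) (children t i)

record Refutes (t : Tree n) (Γ Δ : List (Fm n)) (Λ : List (LeftAtom n)) (Ω : List (RightAtom n)) : Set where
  constructor refutes
  field
    ⊩Γ : All (t ⊩_) Γ
    ⊩Λ : All (t ⊩ˡ_) Λ
    ⊮Δ : All (t ⊮_) Δ
    ⊮Ω : All (λ a → t ⊮ ⌊ a ⌋ʳ) Ω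

open Refutes

refutes-L∧ : Refutes t (A ∷ B ∷ Γ) Δ Λ Ω → Refutes t ((A ∧′ B) ∷ Γ) Δ Λ Ω
refutes-L∧ (refutes (a ∷ b ∷ γ) ℓ δ ω) = refutes ((a , b) ∷ γ) ℓ δ ω

refutes-L∨₁ : Refutes t (A ∷ Γ) Δ Λ Ω → Refutes t ((A ∨′ B) ∷ Γ) Δ Λ Ω
refutes-L∨₁ (refutes (a ∷ γ) ℓ δ ω) = refutes (inj₁ a ∷ γ) ℓ δ ω

refutes-L∨₂ : Refutes t (B ∷ Γ) Δ Λ Ω → Refutes t ((A ∨′ B) ∷ Γ) Δ Λ Ω
refutes-L∨₂ (refutes (b ∷ γ) ℓ δ ω) = refutes (inj₂ b ∷ γ) ℓ δ ω

refutes-L⇒₁ : Refutes t Γ (A ∷ Δ) Λ Ω → Refutes t ((A ⇒′ B) ∷ Γ) Δ Λ Ω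
refutes-L⇒₁ (refutes γ ℓ (¬a ∷ δ) ω) = refutes ((⊥-elim ∘ ¬a) ∷ γ) ℓ δ ω

refutes-L⇒₂ : Refutes t (B ∷ Γ) Δ Λ Ω → Refutes t ((A ⇒′ B) ∷ Γ) Δ Λ Ω
refutes-L⇒₂ (refutes (b ∷ γ) ℓ δ ω) = refutes ((λ _ → b) ∷ γ) ℓ δ ω

refutes-L¬ : Refutes t Γ (A ∷ Δ) Λ Ω → Refutes t ((¬′ A) ∷ Γ) Δ Λ Ω
refutes-L¬ (refutes γ ℓ (¬a ∷ δ) ω) = refutes (¬a ∷ γ) ℓ δ ω

refutes-Lvar : Refutes t Γ Δ (var p ∷ Λ) Ω → Refutes t (var p ∷ Γ) Δ Λ Ω
refutes-Lvar (refutes γ (x ∷ ℓ) δ ω) = refutes (x ∷ γ) ℓ δ ω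

refutes-L□ : ¬ T (reflexive t) → Refutes t Γ Δ (□ i A ∷ Λ) Ω → Refutes t (□ i A ∷ Γ) Δ Λ Ω
refutes-L□ irreflexive (refutes γ (as ∷ ℓ) δ ω) = refutes ((⊥-elim ∘ irreflexive , as) ∷ γ) ℓ δ ω

refutes-L□T : Refutes t (A ∷ Γ) Δ (□ i A ∷ Λ) Ω → Refutes t (□ i A ∷ Γ) Δ Λ Ω
refutes-L□T (refutes (a ∷ γ) (as ∷ ℓ) δ ω) = refutes (((λ _ → a) , as) ∷ γ) ℓ δ ω

refutes-R∧₁ : Refutes t Γ (A ∷ Δ) Λ Ω → Refutes t Γ ((A ∧′ B) ∷ Δ) Λ Ω
refutes-R∧₁ (refutes γ ℓ (¬a ∷ δ) ω) = refutes γ ℓ (¬a ∘ proj₁ ∷ δ) ω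

refutes-R∧₂ : Refutes t Γ (B ∷ Δ) Λ Ω → Refutes t Γ ((A ∧′ B) ∷ Δ) Λ Ω
refutes-R∧₂ (refutes γ ℓ (¬b ∷ δ) ω) = refutes γ ℓ (¬b ∘ proj₂ ∷ δ) ω

refutes-R∨ : Refutes t Γ (A ∷ B ∷ Δ) Λ Ω → Refutes t Γ ((A ∨′ B) ∷ Δ) Λ Ω
refutes-R∨ (refutes γ ℓ (¬a ∷ ¬b ∷ δ) ω) = refutes γ ℓ ([ ¬a , ¬b ] ∷ δ) ω

refutes-R⇒ : Refutes t (A ∷ []) (B ∷ Δ) Λ Ω → Refutes t [] ((A ⇒′ B) ∷ Δ) Λ Ω
refutes-R⇒ (refutes (a ∷ []) ℓ (¬b ∷ δ) ω) = refutes [] ℓ ((λ f → ¬b (f a)) ∷ δ) ω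

refutes-R¬ : Refutes t (A ∷ []) Δ Λ Ω → Refutes t [] ((¬′ A) ∷ Δ) Λ Ω
refutes-R¬ (refutes (a ∷ []) ℓ δ ω) = refutes [] ℓ ((λ ¬a → ¬a a) ∷ δ) ω

refutes-Ratom : ∀ {a} → Refutes t Γ Δ Λ (a ∷ Ω) → Refutes t Γ (⌊ a ⌋ʳ ∷ Δ) Λ Ω
refutes-Ratom (refutes γ ℓ δ (¬x ∷ ω)) = refutes γ ℓ (¬x ∷ δ) ω

-- The successor demanded by seriality when no parked box constrains the agent.
leaf : Tree n
leaf = node true (λ _ → false) (λ _ → [])

leaf-admissible : Admissible L (leaf {n})
leaf-admissible = admissible _ (λ _ → inj₁ _) (λ _ → [])

∈⇒↭ : ∀ {A : Set} {x : A} {xs} → x ∈ xs → ∃ λ ys → xs ↭ x ∷ ys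
∈⇒↭ m with ys , zs , refl ← ∈-∃++ m = ys ++ zs , shift _ ys zs

_∈var?_ : ∀ p (Λ : List (LeftAtom n)) → Dec (var p ∈ Λ)
p ∈var? Λ = any? (p ≟var_) Λ
  where
  _≟var_ : ∀ p (a : LeftAtom n) → Dec (var p ≡ a)
  p ≟var var q = map′ (cong var) (λ { refl → refl }) (p ℕ.≟ q)
  p ≟var □ i A = no λ ()

empty? : ∀ {A : Set} (xs : List A) → xs ≡ [] ⊎ xs ≢ []
empty? []      = inj₁ refl
empty? (_ ∷ _) = inj₂ λ ()

sequence⊎ : ∀ {A D : Set} {P : A → Set} {xs} → (∀ {x} → x ∈ xs → D ⊎ P x) → D ⊎ All P xs
sequence⊎ {D = D} f = All.sequenceA 0ℓ (SumLeft.applicative D 0ℓ) (All.tabulate f)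

forall⊎ : ∀ {D : Set} {P : Fin n → Set} → (∀ i → D ⊎ P i) → D ⊎ (∀ i → P i)
forall⊎ f = Sum.map₂ (λ ps i → lookup ps (∈-allFin i)) (sequence⊎ {xs = allFin _} λ {i} _ → f i)

module Completeness (L : Logic) where

  Derivable : List (Fm n) → List (Fm n) → List (LeftAtom n) → List (RightAtom n) → Set
  Derivable Γ Δ Λ Ω = L ⊢ Γ ++ map ⌊_⌋ˡ Λ ⇒ Δ ++ map ⌊_⌋ʳ Ω

  record Countermodel (Γ Δ : List (Fm n)) (Λ : List (LeftAtom n)) (Ω : List (RightAtom n)) : Set where
    constructor countermodel
    field
      root-val        : ℕ → Bool
      root-children   : Fin n → List (Tree n)
      root-admissible : Admissible L (node (isKT L) root-val root-children)
      root-refutes    : Refutes (node (isKT L) root-val root-children) Γ Δ Λ Ω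

    root : Tree n
    root = node (isKT L) root-val root-children

  open Countermodel

  Result : List (Fm n) → List (Fm n) → List (LeftAtom n) → List (RightAtom n) → Set
  Result Γ Δ Λ Ω = Derivable Γ Δ Λ Ω ⊎ Countermodel Γ Δ Λ Ω

  Refutation : (Γ Δ : List (Fm n)) (Λ : List (LeftAtom n)) (Ω : List (RightAtom n)) →
               (Γ′ Δ′ : List (Fm n)) (Λ′ : List (LeftAtom n)) (Ω′ : List (RightAtom n)) → Set
  Refutation Γ Δ Λ Ω Γ′ Δ′ Λ′ Ω′ =
    ∀ {v k} → Refutes (node (isKT L) v k) Γ Δ Λ Ω → Refutes (node (isKT L) v k) Γ′ Δ′ Λ′ Ω′

  refine : Refutation Γ Δ Λ Ω Γ′ Δ′ Λ′ Ω′ → Countermodel Γ Δ Λ Ω → Countermodel Γ′ Δ′ Λ′ Ω′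
  refine f (countermodel v k a r) = countermodel v k a (f r)

  by₁ : (Derivable Γ Δ Λ Ω → Derivable Γ′ Δ′ Λ′ Ω′) → Refutation Γ Δ Λ Ω Γ′ Δ′ Λ′ Ω′ →
        Result Γ Δ Λ Ω → Result Γ′ Δ′ Λ′ Ω′
  by₁ rule g = Sum.map rule (refine g)

  by₂ : (Derivable Γ Δ Λ Ω → Derivable Γ′ Δ′ Λ′ Ω′ → Derivable Γ″ Δ″ Λ″ Ω″) →
        Refutation Γ Δ Λ Ω Γ″ Δ″ Λ″ Ω″ → Refutation Γ′ Δ′ Λ′ Ω′ Γ″ Δ″ Λ″ Ω″ →
        Result Γ Δ Λ Ω → Result Γ′ Δ′ Λ′ Ω′ → Result Γ″ Δ″ Λ″ Ω″
  by₂ rule g g′ (inj₁ d) (inj₁ d′) = inj₁ (rule d d′)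
  by₂ rule g g′ (inj₂ c) _         = inj₂ (refine g c)
  by₂ rule g g′ (inj₁ _) (inj₂ c′) = inj₂ (refine g′ c′)

  shiftˡ : ∀ (Γ : List (Fm n)) A {Θ Δ} → L ⊢ Γ ++ A ∷ Θ ⇒ Δ → L ⊢ A ∷ Γ ++ Θ ⇒ Δ
  shiftˡ Γ A = perm (shift A Γ _) ↭-refl

  shiftʳ : ∀ (Δ : List (Fm n)) A {Θ Γ} → L ⊢ Γ ⇒ Δ ++ A ∷ Θ → L ⊢ Γ ⇒ A ∷ Δ ++ Θ
  shiftʳ Δ A = perm ↭-refl (shift A Δ _)

  unpark : Derivable Γ Δ [] [] → L ⊢ Γ ⇒ Δ
  unpark {Γ = Γ} {Δ = Δ} = perm (↭-reflexive (++-identityʳ Γ)) (↭-reflexive (++-identityʳ Δ))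

  module Saturated (Λ : List (LeftAtom n)) (Ω : List (RightAtom n))
                   (recurse : ∀ (Γ Δ : List (Fm n)) →
                              measure Γ Δ [] [] < measure [] [] Λ Ω → Result Γ Δ [] [])
                   where

    Child : Fin n → Tree n → Set
    Child i c = Admissible L c × All (c ⊩_) (bodies i Λ)

    Refuted : RightAtom n → Set
    Refuted (var p) = var p ∉ Λ
    Refuted ⊥′      = ⊤
    Refuted (□ i B) = Σ[ c ∈ Tree n ] Child i c × c ⊮ B

    init-derivation : var p ∈ Λ → var p ∈ Ω → Derivable [] [] Λ Ω
    init-derivation {p = p} p∈Λ p∈Ω
      with _ , Λ↭ ← ∈⇒↭ (∈-map⁺ ⌊_⌋ˡ p∈Λ) | _ , Ω↭ ← ∈⇒↭ (∈-map⁺ ⌊_⌋ʳ p∈Ω)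
      = perm (↭-sym Λ↭) (↭-sym Ω↭) (init p)

    □K-derivation : □ i B ∈ Ω → L ⊢ bodies i Λ ⇒ B ∷ [] → Derivable [] [] Λ Ω
    □K-derivation {i = i} m d with _ , Ω↭ ← ∈⇒↭ (∈-map⁺ ⌊_⌋ʳ m) =
      perm (↭-sym (↭-others-bodies i Λ)) (↭-sym Ω↭)
           (□K i (others-SigmaOK i Λ) (All.tail (All-resp-↭ Ω↭ (⌊⌋ʳ-OmegaOK Ω))) d)

    □D-derivation : L ≡ KD → bodies i Λ ≢ [] → L ⊢ bodies i Λ ⇒ [] → Derivable [] [] Λ Ω
    □D-derivation {i = i} L≡KD nonempty d =
      perm (↭-sym (↭-others-bodies i Λ)) ↭-refl
           (□D L≡KD i nonempty (others-SigmaOK i Λ) (⌊⌋ʳ-OmegaOK Ω) d)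

    □K-< : □ i B ∈ Ω → measure (bodies i Λ) (B ∷ []) [] [] < measure [] [] Λ Ω
    □K-< {i = i} {B = B} m = begin-strict
      weights (bodies i Λ ++ B ∷ []) + 0    ≡⟨ +-identityʳ _ ⟩
      weights (bodies i Λ ++ B ∷ [])        ≡⟨ weights-++-∷ (bodies i Λ) B [] ⟩
      weight B + weights (bodies i Λ ++ []) ≡⟨ cong (λ Γ → weight B + weights Γ) (++-identityʳ (bodies i Λ)) ⟩
      weight B + weights (bodies i Λ)       <⟨ +-mono-<-≤ (∈⇒weightʳ≤ Ω m) (m+n≤o⇒m≤o _ (bodies-weight i Λ)) ⟩
      weightsʳ Ω + weightsˡ Λ               ≡⟨ +-comm (weightsʳ Ω) _ ⟩
      weightsˡ Λ + weightsʳ Ω               ∎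
      where
      open ≤-Reasoning

    □D-< : bodies i Λ ≢ [] → measure (bodies i Λ) [] [] [] < measure [] [] Λ Ω
    □D-< {i = i} nonempty = begin-strict
      weights (bodies i Λ ++ []) + 0             ≡⟨ +-identityʳ _ ⟩
      weights (bodies i Λ ++ [])                 ≡⟨ cong weights (++-identityʳ (bodies i Λ)) ⟩
      weights (bodies i Λ)                       <⟨ m<m+n _ (0<length nonempty) ⟩
      weights (bodies i Λ) + length (bodies i Λ) ≤⟨ bodies-weight i Λ ⟩
      weightsˡ Λ                                 ≤⟨ m≤m+n _ _ ⟩
      weightsˡ Λ + weightsʳ Ω                    ∎
      where
      open ≤-Reasoning
      0<length : ∀ {xs : List (Fm n)} → xs ≢ [] → 0 < length xs
      0<length {[]}    xs≢[] = ⊥-elim (xs≢[] refl)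
      0<length {_ ∷ _} _     = s≤s z≤n

    refute : ∀ {a} → a ∈ Ω → Derivable [] [] Λ Ω ⊎ Refuted a
    refute {var p} m with p ∈var? Λ
    ... | yes p∈Λ = inj₁ (init-derivation p∈Λ m)
    ... | no p∉Λ  = inj₂ p∉Λ
    refute {⊥′}    _ = inj₂ _
    refute {□ i B} m =
      Sum.map (□K-derivation m ∘ unpark) witness (recurse (bodies i Λ) (B ∷ []) (□K-< m))
      where
      witness : Countermodel (bodies i Λ) (B ∷ []) [] [] → Refuted (□ i B)
      witness c = root c , (root-admissible c , ⊩Γ (root-refutes c)) , All.head (⊮Δ (root-refutes c))

    serial-child : L ≡ KD → ∀ i → Derivable [] [] Λ Ω ⊎ ∃ (Child i)
    serial-child L≡KD i with empty? (bodies i Λ)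
    ... | inj₁ none     = inj₂ (leaf , leaf-admissible , subst (All _) (sym none) [])
    ... | inj₂ nonempty =
      Sum.map (□D-derivation L≡KD nonempty ∘ unpark) child (recurse (bodies i Λ) [] (□D-< nonempty))
      where
      child : Countermodel (bodies i Λ) [] [] [] → ∃ (Child i)
      child c = root c , root-admissible c , ⊩Γ (root-refutes c)

    children-from : ∀ i Ω′ → All Refuted Ω′ → List (∃ (Child i))
    children-from i []           []                     = []
    children-from i (var _ ∷ Ω′) (_ ∷ rs)               = children-from i Ω′ rs
    children-from i (⊥′ ∷ Ω′)    (_ ∷ rs)               = children-from i Ω′ rs
    children-from i (□ j B ∷ Ω′) ((c , child , _) ∷ rs) with j ≟ i
    ... | yes refl = (c , child) ∷ children-from i Ω′ rs
    ... | no _     = children-from i Ω′ rs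

    children-from-⊮ : ∀ Ω′ (rs : All Refuted Ω′) → □ i B ∈ Ω′ →
                      Any ((_⊮ B) ∘ proj₁) (children-from i Ω′ rs)
    children-from-⊮ {i = i} (□ j _ ∷ Ω′) ((_ , _ , ⊮B) ∷ rs) m with j ≟ i | m
    ... | yes refl | here refl = here ⊮B
    ... | yes refl | there m   = there (children-from-⊮ Ω′ rs m)
    ... | no j≢i   | here refl = ⊥-elim (j≢i refl)
    ... | no _     | there m   = children-from-⊮ Ω′ rs m
    children-from-⊮ (var _ ∷ Ω′) (_ ∷ rs) (there m) = children-from-⊮ Ω′ rs m
    children-from-⊮ (⊥′ ∷ Ω′)    (_ ∷ rs) (there m) = children-from-⊮ Ω′ rs m

    assemble : (extra : ∀ i → List (∃ (Child i))) → (L ≡ KD → ∀ i → extra i ≢ []) →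
               All Refuted Ω → Countermodel [] [] Λ Ω
    assemble extra serial rs = countermodel parked-vars kids
      (admissible T-isKT (λ L≡KD → inj₂ λ i → map-++-≢[] (serial L≡KD i))
                  (All.map proj₁ ∘ kids-Child))
      (refutes [] (All.tabulate atom-holds) [] (All.tabulate atom-fails))
      where
      parked-vars : ℕ → Bool
      parked-vars p = isYes (p ∈var? Λ)

      family : ∀ i → List (∃ (Child i))
      family i = extra i ++ children-from i Ω rs

      kids : Fin n → List (Tree n)
      kids i = map proj₁ (family i)

      kids-Child : ∀ i → All (Child i) (kids i)
      kids-Child i = All-map⁺ (universal proj₂ (family i))

      atom-holds : ∀ {a} → a ∈ Λ → node (isKT L) parked-vars kids ⊩ˡ a
      atom-holds {var p} m = fromWitness m
      atom-holds {□ i B} m =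
        All.map (λ (_ , ⊩bodies) → lookup ⊩bodies (∈-bodies Λ m)) (kids-Child i)

      atom-fails : ∀ {a} → a ∈ Ω → node (isKT L) parked-vars kids ⊮ ⌊ a ⌋ʳ
      atom-fails {var p} m v             = lookup rs m (toWitness v)
      atom-fails {⊥′}    _ ()
      atom-fails {□ i B} m (_ , ⊩B-kids) =
        Any¬⇒¬All (Any-map⁺ (++⁺ʳ (extra i) (children-from-⊮ Ω rs m))) ⊩B-kids

      map-++-≢[] : ∀ {A B : Set} {f : A → B} {xs ys} → xs ≢ [] → map f (xs ++ ys) ≢ []
      map-++-≢[] {xs = []}    xs≢[] = ⊥-elim (xs≢[] refl)
      map-++-≢[] {xs = _ ∷ _} _     = λ ()

    decide : Result [] [] Λ Ω
    decide with sequence⊎ refute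
    ... | inj₁ d  = inj₁ d
    ... | inj₂ rs with KD? L
    ...   | inj₂ L≢KD = inj₂ (assemble (λ _ → []) (⊥-elim ∘ L≢KD) rs)
    ...   | inj₁ L≡KD =
      Sum.map₂ (λ w → assemble (λ i → w i ∷ []) (λ _ _ ()) rs) (forall⊎ (serial-child L≡KD))

  mutual
    search : ∀ Γ Δ Λ Ω → Acc _<_ (measure {n} Γ Δ Λ Ω) → Result Γ Δ Λ Ω
    search (var p ∷ Γ) Δ Λ Ω (acc rs) =
      by₁ (shiftˡ Γ (var p)) refutes-Lvar (search Γ Δ (var p ∷ Λ) Ω (rs ≤-refl))
    search (⊥′ ∷ Γ) Δ Λ Ω _ = inj₁ init⊥
    search ((A ∧′ B) ∷ Γ) Δ Λ Ω (acc rs) =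
      by₁ L∧ refutes-L∧ (search (A ∷ B ∷ Γ) Δ Λ Ω (rs (both-< (weight A) (weight B))))
    search ((A ∨′ B) ∷ Γ) Δ Λ Ω (acc rs) =
      by₂ L∨ refutes-L∨₁ refutes-L∨₂
        (search (A ∷ Γ) Δ Λ Ω (rs (left-< (weight A) (weight B))))
        (search (B ∷ Γ) Δ Λ Ω (rs (right-< (weight A) (weight B))))
    search ((A ⇒′ B) ∷ Γ) Δ Λ Ω (acc rs) =
      by₂ L⇒ refutes-L⇒₁ refutes-L⇒₂
        (search Γ (A ∷ Δ) Λ Ω (rs (moved-< Γ A Δ (left-< (weight A) (weight B)))))
        (search (B ∷ Γ) Δ Λ Ω (rs (right-< (weight A) (weight B))))
    search ((¬′ A) ∷ Γ) Δ Λ Ω (acc rs) =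
      by₁ L¬ refutes-L¬ (search Γ (A ∷ Δ) Λ Ω (rs (moved-< Γ A Δ ≤-refl)))
    search (□ i A ∷ Γ) Δ Λ Ω (acc rs) with KT? L
    ... | inj₂ irreflexive =
      by₁ (shiftˡ Γ (□ i A)) (refutes-L□ irreflexive)
        (search Γ Δ (□ i A ∷ Λ) Ω (rs (□-left-< (weight A))))
    ... | inj₁ L≡KT =
      by₁ (□T L≡KT i ∘ shiftˡ (A ∷ Γ) (□ i A)) refutes-L□T
        (search (A ∷ Γ) Δ (□ i A ∷ Λ) Ω (rs (□-left-reflexive-< (weight A))))
    search [] Δ Λ Ω a = search-right Δ Λ Ω a

    search-right : ∀ Δ Λ Ω → Acc _<_ (measure {n} [] Δ Λ Ω) → Result [] Δ Λ Ω
    search-right (var p ∷ Δ) Λ Ω (acc rs) =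
      by₁ (shiftʳ Δ (var p)) refutes-Ratom (search [] Δ Λ (var p ∷ Ω) (rs ≤-refl))
    search-right (⊥′ ∷ Δ) Λ Ω (acc rs) =
      by₁ (shiftʳ Δ ⊥′) refutes-Ratom (search [] Δ Λ (⊥′ ∷ Ω) (rs ≤-refl))
    search-right (□ i A ∷ Δ) Λ Ω (acc rs) =
      by₁ (shiftʳ Δ (□ i A)) refutes-Ratom
        (search [] Δ Λ (□ i A ∷ Ω) (rs (□-right-< (weight A))))
    search-right ((A ∧′ B) ∷ Δ) Λ Ω (acc rs) =
      by₂ R∧ refutes-R∧₁ refutes-R∧₂
        (search [] (A ∷ Δ) Λ Ω (rs (left-< (weight A) (weight B))))
        (search [] (B ∷ Δ) Λ Ω (rs (right-< (weight A) (weight B))))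
    search-right ((A ∨′ B) ∷ Δ) Λ Ω (acc rs) =
      by₁ R∨ refutes-R∨ (search [] (A ∷ B ∷ Δ) Λ Ω (rs (both-< (weight A) (weight B))))
    search-right ((A ⇒′ B) ∷ Δ) Λ Ω (acc rs) =
      by₁ R⇒ refutes-R⇒ (search (A ∷ []) (B ∷ Δ) Λ Ω (rs (both-< (weight A) (weight B))))
    search-right ((¬′ A) ∷ Δ) Λ Ω (acc rs) =
      by₁ R¬ refutes-R¬ (search (A ∷ []) Δ Λ Ω (rs ≤-refl))
    search-right [] Λ Ω (acc rs) = Saturated.decide Λ Ω λ Γ Δ lt → search Γ Δ [] [] (rs lt)

  H⇒G : H L A → L ⊢ [] ⇒ A ∷ []
  H⇒G {A = A} h with search [] (A ∷ []) [] [] (<-wellFounded _)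
  ... | inj₁ d = d
  ... | inj₂ c = ⊥-elim (All.head (⊮Δ (root-refutes c)) (H-sound h (root-admissible c)))

theorem3p14 : ∀ {n : ℕ} (L : Logic) (A : Fm n) →
    (H L A → L ⊢ [] ⇒ A ∷ []) × (L ⊢ [] ⇒ A ∷ [] → H L A)
theorem3p14 L A = Completeness.H⇒G L , to ⊢ᴴ⇔H ∘ G⇒H
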